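{- Let $T$ be a Latin tableau of shape $\lambda$. All elementary transformations acting on Latin tableaux of shape $\lambda$ pairwise commute (as elements of the isotopy group $\mathscr{S}(\lambda)$) if and only if $\lambda$ is squareable.
   Context: A partition $\lambda=(\lambda_1\ge\cdots\ge\lambda_k)$ of positive integers has Young diagram with left-justified rows, row $i$ of length $\lambda_i$. A Latin tableau of shape $\lambda$ fills the boxes with positive integers so that row $i$ contains each of $1,\dots,\lambda_i$ exactly once and no integer repeats in a column. Elementary transformations: $r_{(i,j)}$ swaps rows $i,j$ (defined when they have equal length), $c_{(i,j)}$ swaps columns $i,j$ (equal length), $s_{(x,y)}$ interchanges entries $x,y$ (defined when $x,y$ appear equally often, equivalently columns $x$ and $y$ of $\lambda$ have equal length). The isotopy group $\mathscr{S}(\lambda)=S_{\mathrm{row}}\times S_{\mathrm{col}}\times S_{\mathrm{ent}}$ is the group generated by these, where $S_{\mathrm{row}}$ is the product over distinct row lengths of the symmetric groups permuting the rows of that length, and $S_{\mathrm{col}}$, $S_{\mathrm{ent}}$ are the analogous products permuting columns of equal length and entries occurring equally often. $\lambda$ is squareable if it has no three rows of the same length and no three columns of the same length. -}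

module Defs where

open import Data.Nat using (ℕ; zero; suc; _+_; _<_; _≤_)
open import Data.Nat.Properties using (_<?_; _≟_)
open import Data.Fin using (Fin; toℕ; zero; suc)
open import Data.Fin.Permutation using (Permutation′; transpose; id; _∘ₚ_; _⟨$⟩ʳ_)
open import Data.Product using (_×_; _,_; Σ; ∃)
open import Relation.Binary.PropositionalEquality using (_≡_; _≢_)
open import Relation.Nullary using (¬_; Dec; yes; no)

record Partition : Set where
  field
    k        : ℕ
    part     : Fin k → ℕ
    positive : ∀ i → 0 < part i
    nonincr  : ∀ (i j : Fin k) → toℕ i ≤ toℕ j → part j ≤ part i
open Partition public

ncols : Partition → ℕ
ncols λ′ with k λ′ | part λ′
... | zero  | _ = 0
... | suc _ | p = p zero

sumFin : (n : ℕ) → (Fin n → ℕ) → ℕ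
sumFin zero    f = 0
sumFin (suc n) f = f zero + sumFin n (λ i → f (suc i))

indicator : ∀ {A : Set} {P : A → Set} → ((a : A) → Dec (P a)) → A → ℕ
indicator d a with d a
... | yes _ = 1
... | no  _ = 0

colLen : (λ′ : Partition) → ℕ → ℕ
colLen λ′ c = sumFin (k λ′) (indicator (λ i → c <? part λ′ i))

Filling : Partition → Set
Filling λ′ = (i : Fin (k λ′)) → Fin (part λ′ i) → ℕ

record IsLatinTableau (λ′ : Partition) (T : Filling λ′) : Set where
  field
    inRange    : ∀ i j → 1 ≤ T i j × T i j ≤ part λ′ i
    rowsHitAll : ∀ i (x : ℕ) → 1 ≤ x → x ≤ part λ′ i → ∃ λ j → T i j ≡ x
    rowInj     : ∀ i (j j′ : Fin (part λ′ i)) → T i j ≡ T i j′ → j ≡ j′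
    colDistinct : ∀ (i i′ : Fin (k λ′)) (j : Fin (part λ′ i)) (j′ : Fin (part λ′ i′)) →
                  toℕ j ≡ toℕ j′ → T i j ≡ T i′ j′ → i ≡ i′

occ : (λ′ : Partition) → Filling λ′ → ℕ → ℕ
occ λ′ T x = sumFin (k λ′) (λ i → sumFin (part λ′ i) (indicator (λ j → T i j ≟ x)))

-- Ambient group containing 𝒮(λ) = S_row × S_col × S_ent: rows are Fin k,
-- columns are Fin λ₁ (column c ↔ toℕ c), entries are Fin λ₁ (entry x ↔ toℕ x + 1).
Iso : Partition → Set
Iso λ′ = Permutation′ (k λ′) × Permutation′ (ncols λ′) × Permutation′ (ncols λ′)

_·_ : ∀ {λ′} → Iso λ′ → Iso λ′ → Iso λ′
(a , b , c) · (a′ , b′ , c′) = (a ∘ₚ a′) , (b ∘ₚ b′) , (c ∘ₚ c′)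

_≈ᵢ_ : ∀ {λ′} → Iso λ′ → Iso λ′ → Set
(a , b , c) ≈ᵢ (a′ , b′ , c′) =
  (∀ x → a ⟨$⟩ʳ x ≡ a′ ⟨$⟩ʳ x) × (∀ x → b ⟨$⟩ʳ x ≡ b′ ⟨$⟩ʳ x) × (∀ x → c ⟨$⟩ʳ x ≡ c′ ⟨$⟩ʳ x)

-- Elementary transformations of Latin tableaux of shape λ (relative to T,
-- for the entry-multiplicity condition).
data Elem (λ′ : Partition) (T : Filling λ′) : Set where
  r : (i j : Fin (k λ′)) → i ≢ j → part λ′ i ≡ part λ′ j → Elem λ′ T
  c : (a b : Fin (ncols λ′)) → a ≢ b → colLen λ′ (toℕ a) ≡ colLen λ′ (toℕ b) → Elem λ′ T
  s : (x y : Fin (ncols λ′)) → x ≢ y →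
      occ λ′ T (suc (toℕ x)) ≡ occ λ′ T (suc (toℕ y)) → Elem λ′ T

toIso : ∀ {λ′ T} → Elem λ′ T → Iso λ′
toIso (r i j _ _) = transpose i j , id , id
toIso (c a b _ _) = id , transpose a b , id
toIso (s x y _ _) = id , id , transpose x y

AllElemCommute : (λ′ : Partition) → Filling λ′ → Set
AllElemCommute λ′ T = ∀ (e f : Elem λ′ T) → _≈ᵢ_ {λ′} (_·_ {λ′} (toIso e) (toIso f)) (_·_ {λ′} (toIso f) (toIso e))

Squareable : Partition → Set
Squareable λ′ =
  (¬ Σ (Fin (k λ′)) λ i → Σ (Fin (k λ′)) λ j → Σ (Fin (k λ′)) λ l →
       i ≢ j × j ≢ l × i ≢ l × part λ′ i ≡ part λ′ j × part λ′ j ≡ part λ′ l)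
  × (¬ Σ (Fin (ncols λ′)) λ a → Σ (Fin (ncols λ′)) λ b → Σ (Fin (ncols λ′)) λ d →
       a ≢ b × b ≢ d × a ≢ d ×
       colLen λ′ (toℕ a) ≡ colLen λ′ (toℕ b) × colLen λ′ (toℕ b) ≡ colLen λ′ (toℕ d))

module Submission where

-- Every elementary transformation is a transposition acting on one of the
-- three factors (rows, columns, entries) of the isotopy group, so
-- transformations of different kinds commute trivially, and the question is
-- when two transpositions (a b), (u v) of points in the same class of a
-- "length" function f commute.  Two facts about transpositions answer it:
--   * (a b) and (u v) commute when the pairs are equal or disjoint;
--   * (i j) and (j l) never commute when i, j, l are distinct.
-- Hence, for any f : Fin n → ℕ, all transpositions inside f-classes commute
-- iff no three points share an f-value: pairs inside classes of size at most
-- two are equal or disjoint (sufficiency), while three alike points give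
-- two non-commuting transpositions (necessity).  This is applied to rows
-- (classified by their lengths) and columns (by theirs); for entries we first
-- show, by counting, that in a Latin tableau the entry x+1 occurs exactly
-- as often as column x is long, so entries are classified by column lengths
-- as well.

open import Defs
open import Data.Product using (_×_; _,_; Σ; proj₁; proj₂)
open import Data.Nat using (ℕ; zero; suc; _+_; _≤_; s≤s; z≤n)
open import Data.Nat.Properties using (_<?_; _≟_)
open import Data.Fin using (Fin; toℕ; zero; suc)
import Data.Fin.Properties as Fin
open import Data.Fin.Permutation
  using (Permutation′; transpose; _∘ₚ_; _⟨$⟩ʳ_; _≈_)
open import Relation.Binary.PropositionalEquality
  using (_≡_; _≢_; refl; sym; trans; cong; cong₂; subst; ≢-sym; module ≡-Reasoning)
open import Relation.Nullary using (¬_; Dec; yes; no)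
open import Data.Empty using (⊥-elim)

private
  variable
    n : ℕ

Commute : Permutation′ n → Permutation′ n → Set
Commute π ρ = (π ∘ₚ ρ) ≈ (ρ ∘ₚ π)

transpose-matchˡ : (i j : Fin n) → transpose i j ⟨$⟩ʳ i ≡ j
transpose-matchˡ i j with i Fin.≟ i
... | yes _  = refl
... | no i≢i = ⊥-elim (i≢i refl)

transpose-matchʳ : (i j : Fin n) → transpose i j ⟨$⟩ʳ j ≡ i
transpose-matchʳ i j with j Fin.≟ i
... | yes j≡i = j≡i
... | no _ with j Fin.≟ j
...   | yes _  = refl
...   | no j≢j = ⊥-elim (j≢j refl)

transpose-fixes : (i j x : Fin n) → x ≢ i → x ≢ j → transpose i j ⟨$⟩ʳ x ≡ x
transpose-fixes i j x x≢i x≢j with x Fin.≟ i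
... | yes x≡i = ⊥-elim (x≢i x≡i)
... | no _ with x Fin.≟ j
...   | yes x≡j = ⊥-elim (x≢j x≡j)
...   | no _    = refl

transpose-sym : (i j : Fin n) → transpose i j ≈ transpose j i
transpose-sym i j x = by-cases (x Fin.≟ i) (x Fin.≟ j)
  where
  by-cases : Dec (x ≡ i) → Dec (x ≡ j) → transpose i j ⟨$⟩ʳ x ≡ transpose j i ⟨$⟩ʳ x
  by-cases (yes refl) _          = trans (transpose-matchˡ x j) (sym (transpose-matchʳ j x))
  by-cases (no _)     (yes refl) = trans (transpose-matchʳ i x) (sym (transpose-matchˡ x i))
  by-cases (no x≢i)   (no x≢j)   =
    trans (transpose-fixes i j x x≢i x≢j) (sym (transpose-fixes j i x x≢j x≢i))

commute-at : (π ρ : Permutation′ n) {x y : Fin n} →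
             π ⟨$⟩ʳ x ≡ y → ρ ⟨$⟩ʳ x ≡ x → ρ ⟨$⟩ʳ y ≡ y →
             (π ∘ₚ ρ) ⟨$⟩ʳ x ≡ (ρ ∘ₚ π) ⟨$⟩ʳ x
commute-at π ρ {x} {y} πx≡y ρx≡x ρy≡y = begin
  ρ ⟨$⟩ʳ (π ⟨$⟩ʳ x) ≡⟨ cong (ρ ⟨$⟩ʳ_) πx≡y ⟩
  ρ ⟨$⟩ʳ y           ≡⟨ ρy≡y ⟩
  y                  ≡⟨ sym πx≡y ⟩
  π ⟨$⟩ʳ x           ≡⟨ cong (π ⟨$⟩ʳ_) (sym ρx≡x) ⟩
  π ⟨$⟩ʳ (ρ ⟨$⟩ʳ x) ∎
  where open ≡-Reasoning

-- Transpositions with disjoint supports commute: every point is fixed,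
-- together with its image, by one of the two.
disjoint-transpositions-commute : (a b u v : Fin n) →
  a ≢ u → a ≢ v → b ≢ u → b ≢ v → Commute (transpose a b) (transpose u v)
disjoint-transpositions-commute a b u v a≢u a≢v b≢u b≢v x =
  by-cases (x Fin.≟ a) (x Fin.≟ b) (x Fin.≟ u) (x Fin.≟ v)
  where
  by-cases : Dec (x ≡ a) → Dec (x ≡ b) → Dec (x ≡ u) → Dec (x ≡ v) →
             (transpose a b ∘ₚ transpose u v) ⟨$⟩ʳ x ≡ (transpose u v ∘ₚ transpose a b) ⟨$⟩ʳ x
  by-cases (yes refl) _ _ _ =
    commute-at (transpose a b) (transpose u v) (transpose-matchˡ a b)
      (transpose-fixes u v a a≢u a≢v) (transpose-fixes u v b b≢u b≢v)
  by-cases (no _) (yes refl) _ _ =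
    commute-at (transpose a b) (transpose u v) (transpose-matchʳ a b)
      (transpose-fixes u v b b≢u b≢v) (transpose-fixes u v a a≢u a≢v)
  by-cases (no _) (no _) (yes refl) _ = sym
    (commute-at (transpose u v) (transpose a b) (transpose-matchˡ u v)
      (transpose-fixes a b u (≢-sym a≢u) (≢-sym b≢u))
      (transpose-fixes a b v (≢-sym a≢v) (≢-sym b≢v)))
  by-cases (no _) (no _) (no _) (yes refl) = sym
    (commute-at (transpose u v) (transpose a b) (transpose-matchʳ u v)
      (transpose-fixes a b v (≢-sym a≢v) (≢-sym b≢v))
      (transpose-fixes a b u (≢-sym a≢u) (≢-sym b≢u)))
  by-cases (no x≢a) (no x≢b) (no x≢u) (no x≢v) =
    commute-at (transpose a b) (transpose u v) (transpose-fixes a b x x≢a x≢b)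
      (transpose-fixes u v x x≢u x≢v) (transpose-fixes u v x x≢u x≢v)

-- Transpositions sharing exactly one point do not commute: at i, the
-- composites give l and j respectively.
overlapping-transpositions-don't-commute : (i j l : Fin n) →
  i ≢ j → j ≢ l → i ≢ l → ¬ Commute (transpose i j) (transpose j l)
overlapping-transpositions-don't-commute i j l i≢j j≢l i≢l commute =
  j≢l (sym (begin
    l                                         ≡⟨ sym (transpose-matchˡ j l) ⟩
    transpose j l ⟨$⟩ʳ j                       ≡⟨ cong (transpose j l ⟨$⟩ʳ_) (sym (transpose-matchˡ i j)) ⟩
    transpose j l ⟨$⟩ʳ (transpose i j ⟨$⟩ʳ i) ≡⟨ commute i ⟩
    transpose i j ⟨$⟩ʳ (transpose j l ⟨$⟩ʳ i) ≡⟨ cong (transpose i j ⟨$⟩ʳ_) (transpose-fixes j l i i≢j i≢l) ⟩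
    transpose i j ⟨$⟩ʳ i                       ≡⟨ transpose-matchˡ i j ⟩
    j                                         ∎))
  where open ≡-Reasoning

NoThreeAlike : (Fin n → ℕ) → Set
NoThreeAlike {n} f = ¬ Σ (Fin n) λ i → Σ (Fin n) λ j → Σ (Fin n) λ l →
  i ≢ j × j ≢ l × i ≢ l × f i ≡ f j × f j ≡ f l

data SameOrDisjoint {n} (a b : Fin n) : Fin n → Fin n → Set where
  same     : SameOrDisjoint a b a b
  flipped  : SameOrDisjoint a b b a
  disjoint : ∀ {u v} → a ≢ u → a ≢ v → b ≢ u → b ≢ v → SameOrDisjoint a b u v

-- If f-classes have at most two elements, two pairs each lying in a class are
-- equal or disjoint: sharing exactly one point would put three in a class.
classPairs-sameOrDisjoint : (f : Fin n → ℕ) → NoThreeAlike f → {a b u v : Fin n} →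
  a ≢ b → f a ≡ f b → u ≢ v → f u ≡ f v → SameOrDisjoint a b u v
classPairs-sameOrDisjoint f noThree {a} {b} {u} {v} a≢b fa≡fb u≢v fu≡fv
  with a Fin.≟ u | a Fin.≟ v | b Fin.≟ u | b Fin.≟ v
... | yes refl | _        | _        | yes refl = same
... | yes refl | _        | _        | no b≢v   =
  ⊥-elim (noThree (b , a , v , ≢-sym a≢b , u≢v , b≢v , sym fa≡fb , fu≡fv))
... | no _     | yes refl | yes refl | _        = flipped
... | no a≢u   | yes refl | no b≢u   | _        =
  ⊥-elim (noThree (b , a , u , ≢-sym a≢b , a≢u , b≢u , sym fa≡fb , sym fu≡fv))
... | no _     | no a≢v   | yes refl | _        =
  ⊥-elim (noThree (a , b , v , a≢b , u≢v , a≢v , fa≡fb , fu≡fv))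
... | no a≢u   | no _     | no _     | yes refl =
  ⊥-elim (noThree (a , b , u , a≢b , ≢-sym u≢v , a≢u , fa≡fb , sym fu≡fv))
... | no a≢u   | no a≢v   | no b≢u   | no b≢v   = disjoint a≢u a≢v b≢u b≢v

sameOrDisjoint-commute : {a b u v : Fin n} → SameOrDisjoint a b u v →
                         Commute (transpose a b) (transpose u v)
sameOrDisjoint-commute                  same    _ = refl
sameOrDisjoint-commute {a = a} {b = b} flipped x =
  trans (transpose-sym b a (transpose a b ⟨$⟩ʳ x))
        (cong (transpose a b ⟨$⟩ʳ_) (transpose-sym a b x))
sameOrDisjoint-commute {a = a} {b} {u} {v} (disjoint a≢u a≢v b≢u b≢v) =
  disjoint-transpositions-commute a b u v a≢u a≢v b≢u b≢v

ClassTranspositionsCommute : (Fin n → ℕ) → Set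
ClassTranspositionsCommute {n} f = {a b u v : Fin n} →
  a ≢ b → f a ≡ f b → u ≢ v → f u ≡ f v → Commute (transpose a b) (transpose u v)

noThreeAlike⇒classTranspositionsCommute : (f : Fin n → ℕ) →
  NoThreeAlike f → ClassTranspositionsCommute f
noThreeAlike⇒classTranspositionsCommute f noThree a≢b fa≡fb u≢v fu≡fv =
  sameOrDisjoint-commute (classPairs-sameOrDisjoint f noThree a≢b fa≡fb u≢v fu≡fv)

classTranspositionsCommute⇒noThreeAlike : (f : Fin n → ℕ) →
  ClassTranspositionsCommute f → NoThreeAlike f
classTranspositionsCommute⇒noThreeAlike f commute (i , j , l , i≢j , j≢l , i≢l , fi≡fj , fj≡fl) =
  overlapping-transpositions-don't-commute i j l i≢j j≢l i≢l (commute i≢j fi≡fj j≢l fj≡fl)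

noThreeAlike-cong : (f g : Fin n → ℕ) → (∀ x → f x ≡ g x) → NoThreeAlike g → NoThreeAlike f
noThreeAlike-cong f g f≗g noThree (i , j , l , i≢j , j≢l , i≢l , fi≡fj , fj≡fl) =
  noThree (i , j , l , i≢j , j≢l , i≢l ,
           trans (sym (f≗g i)) (trans fi≡fj (f≗g j)) ,
           trans (sym (f≗g j)) (trans fj≡fl (f≗g l)))

sumFin-cong : (f g : Fin n → ℕ) → (∀ i → f i ≡ g i) → sumFin n f ≡ sumFin n g
sumFin-cong {zero}  f g f≗g = refl
sumFin-cong {suc n} f g f≗g =
  cong₂ _+_ (f≗g zero) (sumFin-cong (λ i → f (suc i)) (λ i → g (suc i)) (λ i → f≗g (suc i)))

module _ {A : Set} {P : A → Set} (P? : (a : A) → Dec (P a)) where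

  indicator-yes : ∀ a → P a → indicator P? a ≡ 1
  indicator-yes a p with P? a
  ... | yes _  = refl
  ... | no ¬p  = ⊥-elim (¬p p)

  indicator-no : ∀ a → ¬ P a → indicator P? a ≡ 0
  indicator-no a ¬p with P? a
  ... | yes p = ⊥-elim (¬p p)
  ... | no _  = refl

count-step : {P : Fin (suc n) → Set} (P? : (a : Fin (suc n)) → Dec (P a)) →
  sumFin (suc n) (indicator P?) ≡ indicator P? zero + sumFin n (indicator (λ j → P? (suc j)))
count-step {n} P? = cong (indicator P? zero +_) (sumFin-cong _ _ tail)
  where
  tail : ∀ i → indicator P? (suc i) ≡ indicator (λ j → P? (suc j)) i
  tail i with P? (suc i)
  ... | yes _ = refl
  ... | no _  = refl

count-none : {P : Fin n → Set} (P? : (a : Fin n) → Dec (P a)) →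
             (∀ j → ¬ P j) → sumFin n (indicator P?) ≡ 0
count-none {zero}  P? none = refl
count-none {suc n} P? none = begin
  sumFin (suc n) (indicator P?)                          ≡⟨ count-step P? ⟩
  indicator P? zero + sumFin n (indicator (λ j → P? (suc j)))
    ≡⟨ cong₂ _+_ (indicator-no P? zero (none zero)) (count-none (λ j → P? (suc j)) (λ j → none (suc j))) ⟩
  0                                                      ∎
  where open ≡-Reasoning

count-unique : {P : Fin n → Set} (P? : (a : Fin n) → Dec (P a)) (j₀ : Fin n) → P j₀ →
               (∀ j j′ → P j → P j′ → j ≡ j′) → sumFin n (indicator P?) ≡ 1
count-unique {suc n} P? zero pj₀ unique = begin
  sumFin (suc n) (indicator P?)                          ≡⟨ count-step P? ⟩
  indicator P? zero + sumFin n (indicator (λ j → P? (suc j)))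
    ≡⟨ cong₂ _+_ (indicator-yes P? zero pj₀)
                 (count-none (λ j → P? (suc j)) (λ j p → Fin.0≢1+n (unique zero (suc j) pj₀ p))) ⟩
  1                                                      ∎
  where open ≡-Reasoning
count-unique {suc n} P? (suc j₀) pj₀ unique = begin
  sumFin (suc n) (indicator P?)                          ≡⟨ count-step P? ⟩
  indicator P? zero + sumFin n (indicator (λ j → P? (suc j)))
    ≡⟨ cong₂ _+_ (indicator-no P? zero (λ p → Fin.0≢1+n (unique zero (suc j₀) p pj₀)))
                 (count-unique (λ j → P? (suc j)) j₀ pj₀
                    (λ j j′ p p′ → Fin.suc-injective (unique (suc j) (suc j′) p p′))) ⟩
  1                                                      ∎
  where open ≡-Reasoning

-- Row i contains the entry m+1 exactly once if m < λᵢ and never otherwise,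
-- so m+1 occurs in as many rows as column m has boxes.
latin-occ≡colLen : (λ′ : Partition) (T : Filling λ′) → IsLatinTableau λ′ T →
                   ∀ m → occ λ′ T (suc m) ≡ colLen λ′ m
latin-occ≡colLen λ′ T latin m = sumFin-cong _ _ occurrencesInRow
  where
  open IsLatinTableau latin
  occurrencesInRow : ∀ i → sumFin (part λ′ i) (indicator (λ j → T i j ≟ suc m))
                         ≡ indicator (λ i → m <? part λ′ i) i
  occurrencesInRow i with m <? part λ′ i
  ... | yes m<λᵢ with rowsHitAll i (suc m) (s≤s z≤n) m<λᵢ
  ...   | j₀ , Tij₀≡m+1 = count-unique (λ j → T i j ≟ suc m) j₀ Tij₀≡m+1
                            (λ j j′ Tij≡m+1 Tij′≡m+1 → rowInj i j j′ (trans Tij≡m+1 (sym Tij′≡m+1)))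
  occurrencesInRow i | no m≮λᵢ = count-none (λ j → T i j ≟ suc m)
    (λ j Tij≡m+1 → m≮λᵢ (subst (_≤ part λ′ i) Tij≡m+1 (proj₂ (inRange i j))))

lemma5p3 : (λ′ : Partition) (T : Filling λ′) → IsLatinTableau λ′ T →
           (AllElemCommute λ′ T → Squareable λ′) × (Squareable λ′ → AllElemCommute λ′ T)
lemma5p3 λ′ T latin = necessity , sufficiency
  where
  necessity : AllElemCommute λ′ T → Squareable λ′
  necessity allCommute =
      classTranspositionsCommute⇒noThreeAlike (part λ′)
        (λ a≢b p u≢v q → proj₁ (allCommute (r _ _ a≢b p) (r _ _ u≢v q)))
    , classTranspositionsCommute⇒noThreeAlike _
        (λ a≢b p u≢v q → proj₁ (proj₂ (allCommute (c _ _ a≢b p) (c _ _ u≢v q))))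

  sufficiency : Squareable λ′ → AllElemCommute λ′ T
  sufficiency (noThreeRows , noThreeCols) = commute
    where
    rows : ClassTranspositionsCommute (part λ′)
    rows = noThreeAlike⇒classTranspositionsCommute _ noThreeRows

    cols : ClassTranspositionsCommute (λ a → colLen λ′ (toℕ a))
    cols = noThreeAlike⇒classTranspositionsCommute _ noThreeCols

    entries : ClassTranspositionsCommute (λ x → occ λ′ T (suc (toℕ x)))
    entries = noThreeAlike⇒classTranspositionsCommute _
      (noThreeAlike-cong _ _ (λ x → latin-occ≡colLen λ′ T latin (toℕ x)) noThreeCols)

    commute : AllElemCommute λ′ T
    commute (r _ _ a≢b p) (r _ _ u≢v q) = rows a≢b p u≢v q , (λ _ → refl) , (λ _ → refl)
    commute (c _ _ a≢b p) (c _ _ u≢v q) = (λ _ → refl) , cols a≢b p u≢v q , (λ _ → refl)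
    commute (s _ _ a≢b p) (s _ _ u≢v q) = (λ _ → refl) , (λ _ → refl) , entries a≢b p u≢v q
    commute (r _ _ _ _) (c _ _ _ _) = (λ _ → refl) , (λ _ → refl) , (λ _ → refl)
    commute (r _ _ _ _) (s _ _ _ _) = (λ _ → refl) , (λ _ → refl) , (λ _ → refl)
    commute (c _ _ _ _) (r _ _ _ _) = (λ _ → refl) , (λ _ → refl) , (λ _ → refl)
    commute (c _ _ _ _) (s _ _ _ _) = (λ _ → refl) , (λ _ → refl) , (λ _ → refl)
    commute (s _ _ _ _) (r _ _ _ _) = (λ _ → refl) , (λ _ → refl) , (λ _ → refl)
    commute (s _ _ _ _) (c _ _ _ _) = (λ _ → refl) , (λ _ → refl) , (λ _ → refl)
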